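{- For every finite graph $H$, $p^3$ divides $\Delta_H(p)$.
   Context: For $p\in[0,1]$ define the kernel $U_p:[0,1]^2\to\mathbb{R}$ by $U_p(x,y)=2p-1$ if $(x,y)\in[0,1/2)^2$ or $(x,y)\in[1/2,1]^2$, and $U_p(x,y)=-1$ otherwise. For a graph $H$, $t_H(U)=\int_{[0,1]^{v(H)}}\prod_{ij\in E(H)}U(x_i,x_j)\prod_i dx_i$, and $\Delta_H(p):=t_H(U_p)-(p-1)^{e(H)}$, which is a polynomial in $p$; divisibility is in $\mathbb{R}[p]$. -}

module Defs where

open import Data.Bool using (Bool; true; false; if_then_else_; _∧_)
open import Data.Nat as ℕ using (ℕ; zero; suc)
open import Data.Fin using (Fin; toℕ)
open import Data.List using (List; []; _∷_; map; concatMap; foldr; length; filterᵇ)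
open import Data.List using (allFin)
open import Data.Vec using (Vec; lookup)
import Data.Vec as Vec
open import Data.Rational using (ℚ; 0ℚ; 1ℚ; ½; -_) renaming (_+_ to _+ℚ_; _*_ to _*ℚ_)
open import Data.Product using (Σ; _×_; _,_)
open import Relation.Binary.PropositionalEquality using (_≡_)

record Graph : Set where
  field
    n     : ℕ
    adj   : Fin n → Fin n → Bool
    sym   : ∀ i j → adj i j ≡ adj j i
    irref : ∀ i → adj i i ≡ false
open Graph public

edges : (H : Graph) → List (Fin (n H) × Fin (n H))
edges H = filterᵇ (λ { (i , j) → (toℕ i ℕ.<ᵇ toℕ j) ∧ adj H i j })
                  (concatMap (λ i → map (λ j → (i , j)) (allFin (n H))) (allFin (n H)))

e : Graph → ℕ
e H = length (edges H)

-- Univariate polynomials (in p) with rational coefficients,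
-- as coefficient lists: the k-th entry is the coefficient of p^k.

Poly : Set
Poly = List ℚ

coeff : Poly → ℕ → ℚ
coeff []       _       = 0ℚ
coeff (a ∷ _)  zero    = a
coeff (_ ∷ as) (suc k) = coeff as k

infixl 6 _+P_
infixl 7 _*P_ _·P_

_+P_ : Poly → Poly → Poly
[]       +P q        = q
(a ∷ as) +P []       = a ∷ as
(a ∷ as) +P (b ∷ bs) = (a +ℚ b) ∷ (as +P bs)

_·P_ : ℚ → Poly → Poly
c ·P q = map (c *ℚ_) q

_*P_ : Poly → Poly → Poly
[]       *P q = []
(a ∷ as) *P q = (a ·P q) +P (0ℚ ∷ (as *P q))

negP : Poly → Poly
negP q = map -_ q

oneP : Poly
oneP = 1ℚ ∷ []

X : Poly
X = 0ℚ ∷ 1ℚ ∷ []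

_^P_ : Poly → ℕ → Poly
q ^P zero  = oneP
q ^P suc k = q *P (q ^P k)

sumP : List Poly → Poly
sumP = foldr _+P_ []

prodP : List Poly → Poly
prodP = foldr _*P_ oneP

-- polynomial equality (coefficientwise, so trailing zeros are irrelevant)
_≈P_ : Poly → Poly → Set
f ≈P g = ∀ k → coeff f k ≡ coeff g k

_∣P_ : Poly → Poly → Set
d ∣P f = Σ Poly (λ q → f ≈P (d *P q))

-- The kernel U_p, as a polynomial in p.  Points of [0,1] are classified
-- by which half they lie in: false ↔ [0,1/2), true ↔ [1/2,1].

twoPm1 : Poly
twoPm1 = (- 1ℚ) ∷ (1ℚ +ℚ 1ℚ) ∷ []

pm1 : Poly
pm1 = (- 1ℚ) ∷ 1ℚ ∷ []

U : Bool → Bool → Poly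
U true  true  = twoPm1
U false false = twoPm1
U _     _     = (- 1ℚ) ∷ []

assignments : (m : ℕ) → List (Vec Bool m)
assignments zero    = Vec.[] ∷ []
assignments (suc m) = concatMap (λ v → (false Vec.∷ v) ∷ (true Vec.∷ v) ∷ []) (assignments m)

halfPow : ℕ → ℚ
halfPow zero    = 1ℚ
halfPow (suc k) = ½ *ℚ halfPow k

-- t_H(U_p): the integral over [0,1]^{v(H)} of ∏_{ij ∈ E(H)} U_p(x_i,x_j).
-- U_p is constant on the 2^{v(H)} boxes (product of halves), each of
-- measure 2^{-v(H)}, so the integral is the following finite average.
tU : Graph → Poly
tU H = halfPow (n H) ·P
       sumP (map (λ σ → prodP (map (λ { (i , j) → U (lookup σ i) (lookup σ j) }) (edges H)))
                 (assignments (n H)))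

Δ : Graph → Poly
Δ H = tU H +P negP (pm1 ^P e H)

{-# OPTIONS --safe #-}
module Submission where

-- Write U_p = (p - 1) + p W, where W(x,y) = s(x) s(y) for the sign s = ±1 of the half
-- containing x.  Modulo p³ the product over the edges is
--   (p - 1)^e(H) · (1 - e₁ p + (e₂ - e₁) p²),
-- with e₁, e₂ the elementary symmetric polynomials of the edge signs W(x_i,x_j).  Averaging
-- over the halves, every W(x_i,x_j) and every product of two of them over distinct edges has
-- mean zero: flipping a vertex lying on exactly one of the edges negates it.  Hence
-- t_H(U_p) ≡ (p - 1)^e(H) mod p³.

open import Defs hiding (sym)

open import Data.Bool using (Bool; true; false; not; T?; _∧_)
open import Data.Bool.Properties using (T-∧)
open import Data.Nat as ℕ using (ℕ; zero; suc)
open import Data.Nat.Properties using (<ᵇ⇒<)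
open import Data.Fin using (Fin; toℕ; _<_) renaming (zero to fzero; suc to fsuc)
open import Data.Fin.Properties using (_≟_; <⇒≢; <-trans)
open import Data.List using (List; []; _∷_; map; foldr; length; drop; concatMap; cartesianProduct; allFin; _++_)
open import Data.List.Properties using (map-cong)
open import Data.List.Relation.Unary.All as All using (All; []; _∷_)
open import Data.List.Relation.Unary.All.Properties using (all-filter)
open import Data.List.Relation.Unary.AllPairs using ([]; _∷_)
open import Data.List.Relation.Unary.Unique.Propositional using (Unique)
open import Data.List.Relation.Unary.Unique.Propositional.Properties
  using (filter⁺; cartesianProduct⁺; allFin⁺)
open import Data.Product using (_×_; _,_; proj₁; proj₂; uncurry)
open import Data.Rational using (ℚ; 0ℚ; 1ℚ; ½; _+_; _*_; -_)
open import Data.Rational.Properties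
  using (+-assoc; +-identityˡ; +-identityʳ; +-inverseʳ; +-comm; *-identityˡ; *-identityʳ; *-zeroˡ; *-zeroʳ;
         *-distribˡ-+; neg-distrib-+; neg-distribˡ-*)
open import Data.Rational.Solver using (module +-*-Solver)
open import Data.Vec using (Vec; _∷_; lookup; updateAt)
open import Data.Vec.Properties using (lookup∘updateAt; lookup∘updateAt′)
open import Function using (_∘_)
open import Function.Bundles using (module Equivalence)
open import Relation.Binary.PropositionalEquality
  using (_≡_; _≢_; refl; sym; trans; cong; cong₂; subst; ≢-sym; module ≡-Reasoning)
open import Relation.Nullary using (yes; no)

open +-*-Solver
open ≡-Reasoning

coeff-+P : ∀ f g k → coeff (f +P g) k ≡ coeff f k + coeff g k
coeff-+P []       g        k       = sym (+-identityˡ _)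
coeff-+P (a ∷ f)  []       k       = sym (+-identityʳ _)
coeff-+P (a ∷ f)  (b ∷ g)  zero    = refl
coeff-+P (a ∷ f)  (b ∷ g)  (suc k) = coeff-+P f g k

coeff-·P : ∀ c f k → coeff (c ·P f) k ≡ c * coeff f k
coeff-·P c []      k       = sym (*-zeroʳ c)
coeff-·P c (a ∷ f) zero    = refl
coeff-·P c (a ∷ f) (suc k) = coeff-·P c f k

coeff-negP : ∀ f k → coeff (negP f) k ≡ - coeff f k
coeff-negP []      k       = refl
coeff-negP (a ∷ f) zero    = refl
coeff-negP (a ∷ f) (suc k) = coeff-negP f k

coeff-drop : ∀ n f k → coeff (drop n f) k ≡ coeff f (n ℕ.+ k)
coeff-drop zero    f       k = refl
coeff-drop (suc n) []      k = refl
coeff-drop (suc n) (a ∷ f) k = coeff-drop n f k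

coeff-∷-*P : ∀ a f g k → coeff ((a ∷ f) *P g) k ≡ a * coeff g k + coeff (0ℚ ∷ (f *P g)) k
coeff-∷-*P a f g k =
  trans (coeff-+P (a ·P g) _ k) (cong (_+ coeff (0ℚ ∷ (f *P g)) k) (coeff-·P a g k))

coeff₀-*P : ∀ f g → coeff (f *P g) 0 ≡ coeff f 0 * coeff g 0
coeff₀-*P []      g = sym (*-zeroˡ (coeff g 0))
coeff₀-*P (a ∷ f) g = trans (coeff-∷-*P a f g 0) (+-identityʳ _)

coeff₁-*P : ∀ f g → coeff (f *P g) 1 ≡ coeff f 0 * coeff g 1 + coeff f 1 * coeff g 0
coeff₁-*P []      g = solve 2 (λ x y → con 0ℚ := con 0ℚ :* x :+ con 0ℚ :* y)
                              refl (coeff g 1) (coeff g 0)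
coeff₁-*P (a ∷ f) g = trans (coeff-∷-*P a f g 1) (cong (a * coeff g 1 +_) (coeff₀-*P f g))

coeff₂-*P : ∀ f g →
  coeff (f *P g) 2 ≡ coeff f 0 * coeff g 2 + coeff f 1 * coeff g 1 + coeff f 2 * coeff g 0
coeff₂-*P []      g = solve 3 (λ x y z → con 0ℚ := con 0ℚ :* x :+ con 0ℚ :* y :+ con 0ℚ :* z)
                              refl (coeff g 2) (coeff g 1) (coeff g 0)
coeff₂-*P (a ∷ f) g = begin
  coeff ((a ∷ f) *P g) 2
    ≡⟨ coeff-∷-*P a f g 2 ⟩
  a * coeff g 2 + coeff (f *P g) 1
    ≡⟨ cong (a * coeff g 2 +_) (coeff₁-*P f g) ⟩
  a * coeff g 2 + (coeff f 0 * coeff g 1 + coeff f 1 * coeff g 0)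
    ≡⟨ sym (+-assoc (a * coeff g 2) (coeff f 0 * coeff g 1) (coeff f 1 * coeff g 0)) ⟩
  a * coeff g 2 + coeff f 0 * coeff g 1 + coeff f 1 * coeff g 0
    ∎

0∷-*P : ∀ f g → ((0ℚ ∷ f) *P g) ≈P (0ℚ ∷ (f *P g))
0∷-*P f g k = trans (coeff-∷-*P 0ℚ f g k)
  (trans (cong (_+ coeff (0ℚ ∷ (f *P g)) k) (*-zeroˡ (coeff g k)))
         (+-identityˡ (coeff (0ℚ ∷ (f *P g)) k)))

oneP-*P : ∀ g → (oneP *P g) ≈P g
oneP-*P g k = trans (coeff-∷-*P 1ℚ [] g k)
  (trans (cong₂ _+_ (*-identityˡ (coeff g k)) (coeff-0∷[] k)) (+-identityʳ (coeff g k)))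
  where
  coeff-0∷[] : ∀ k → coeff (0ℚ ∷ []) k ≡ 0ℚ
  coeff-0∷[] zero    = refl
  coeff-0∷[] (suc k) = refl

X³-*P : ∀ g → (X ^P 3 *P g) ≈P (0ℚ ∷ 0ℚ ∷ 0ℚ ∷ g)
X³-*P g 0                   = 0∷-*P (X ^P 2) g 0
X³-*P g 1                   = trans (0∷-*P (X ^P 2) g 1) (0∷-*P X g 0)
X³-*P g 2                   = trans (0∷-*P (X ^P 2) g 2) (trans (0∷-*P X g 1) (0∷-*P oneP g 0))
X³-*P g (suc (suc (suc k))) =
  trans (0∷-*P (X ^P 2) g _) (trans (0∷-*P X g _) (trans (0∷-*P oneP g _) (oneP-*P g k)))

X³∣P : ∀ f → coeff f 0 ≡ 0ℚ → coeff f 1 ≡ 0ℚ → coeff f 2 ≡ 0ℚ → (X ^P 3) ∣P f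
X³∣P f f₀ f₁ f₂ = drop 3 f , λ k → trans (shifted k) (sym (X³-*P (drop 3 f) k))
  where
  shifted : f ≈P (0ℚ ∷ 0ℚ ∷ 0ℚ ∷ drop 3 f)
  shifted 0                   = f₀
  shifted 1                   = f₁
  shifted 2                   = f₂
  shifted (suc (suc (suc k))) = sym (coeff-drop 3 f k)

-- ℚ[p]/(p³), with jet : Poly → Jet (below) the quotient map.

record Jet : Set where
  constructor ⟨_,_,_⟩
  field
    j₀ j₁ j₂ : ℚ
open Jet

⟨⟩-cong : ∀ {a₀ a₁ a₂ b₀ b₁ b₂} → a₀ ≡ b₀ → a₁ ≡ b₁ → a₂ ≡ b₂ →
          ⟨ a₀ , a₁ , a₂ ⟩ ≡ ⟨ b₀ , b₁ , b₂ ⟩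
⟨⟩-cong refl refl refl = refl

infixl 7 _*ʲ_
_*ʲ_ : Jet → Jet → Jet
⟨ a₀ , a₁ , a₂ ⟩ *ʲ ⟨ b₀ , b₁ , b₂ ⟩ =
  ⟨ a₀ * b₀ , a₀ * b₁ + a₁ * b₀ , a₀ * b₂ + a₁ * b₁ + a₂ * b₀ ⟩

*ʲ-comm : ∀ a b → a *ʲ b ≡ b *ʲ a
*ʲ-comm ⟨ a₀ , a₁ , a₂ ⟩ ⟨ b₀ , b₁ , b₂ ⟩ = ⟨⟩-cong
  (solve 2 (λ a₀ b₀ → a₀ :* b₀ := b₀ :* a₀) refl a₀ b₀)
  (solve 4 (λ a₀ a₁ b₀ b₁ → a₀ :* b₁ :+ a₁ :* b₀ := b₀ :* a₁ :+ b₁ :* a₀) refl a₀ a₁ b₀ b₁)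
  (solve 6 (λ a₀ a₁ a₂ b₀ b₁ b₂ →
              a₀ :* b₂ :+ a₁ :* b₁ :+ a₂ :* b₀ := b₀ :* a₂ :+ b₁ :* a₁ :+ b₂ :* a₀)
         refl a₀ a₁ a₂ b₀ b₁ b₂)

*ʲ-assoc : ∀ a b c → a *ʲ b *ʲ c ≡ a *ʲ (b *ʲ c)
*ʲ-assoc ⟨ a₀ , a₁ , a₂ ⟩ ⟨ b₀ , b₁ , b₂ ⟩ ⟨ c₀ , c₁ , c₂ ⟩ = ⟨⟩-cong
  (solve 3 (λ a₀ b₀ c₀ → a₀ :* b₀ :* c₀ := a₀ :* (b₀ :* c₀)) refl a₀ b₀ c₀)
  (solve 6 (λ a₀ a₁ b₀ b₁ c₀ c₁ →
              a₀ :* b₀ :* c₁ :+ (a₀ :* b₁ :+ a₁ :* b₀) :* c₀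
           := a₀ :* (b₀ :* c₁ :+ b₁ :* c₀) :+ a₁ :* (b₀ :* c₀))
         refl a₀ a₁ b₀ b₁ c₀ c₁)
  (solve 9 (λ a₀ a₁ a₂ b₀ b₁ b₂ c₀ c₁ c₂ →
              a₀ :* b₀ :* c₂ :+ (a₀ :* b₁ :+ a₁ :* b₀) :* c₁
                :+ (a₀ :* b₂ :+ a₁ :* b₁ :+ a₂ :* b₀) :* c₀
           := a₀ :* (b₀ :* c₂ :+ b₁ :* c₁ :+ b₂ :* c₀) :+ a₁ :* (b₀ :* c₁ :+ b₁ :* c₀)
                :+ a₂ :* (b₀ :* c₀))
         refl a₀ a₁ a₂ b₀ b₁ b₂ c₀ c₁ c₂)

*ʲ-interchange : ∀ a b c d → a *ʲ b *ʲ (c *ʲ d) ≡ a *ʲ c *ʲ (b *ʲ d)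
*ʲ-interchange a b c d = begin
  a *ʲ b *ʲ (c *ʲ d)    ≡⟨ *ʲ-assoc a b _ ⟩
  a *ʲ (b *ʲ (c *ʲ d))  ≡⟨ cong (a *ʲ_) (sym (*ʲ-assoc b c d)) ⟩
  a *ʲ (b *ʲ c *ʲ d)    ≡⟨ cong (λ x → a *ʲ (x *ʲ d)) (*ʲ-comm b c) ⟩
  a *ʲ (c *ʲ b *ʲ d)    ≡⟨ cong (a *ʲ_) (*ʲ-assoc c b d) ⟩
  a *ʲ (c *ʲ (b *ʲ d))  ≡⟨ sym (*ʲ-assoc a c _) ⟩
  a *ʲ c *ʲ (b *ʲ d)    ∎

jet : Poly → Jet
jet f = ⟨ coeff f 0 , coeff f 1 , coeff f 2 ⟩

jet-*P : ∀ f g → jet (f *P g) ≡ jet f *ʲ jet g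
jet-*P f g = ⟨⟩-cong (coeff₀-*P f g) (coeff₁-*P f g) (coeff₂-*P f g)

X³∣P-difference : ∀ f g → jet f ≡ jet g → (X ^P 3) ∣P (f +P negP g)
X³∣P-difference f g f≡g =
  X³∣P (f +P negP g) (vanish 0 (cong j₀ f≡g)) (vanish 1 (cong j₁ f≡g)) (vanish 2 (cong j₂ f≡g))
  where
  vanish : ∀ k → coeff f k ≡ coeff g k → coeff (f +P negP g) k ≡ 0ℚ
  vanish k fₖ≡gₖ = trans (coeff-+P f (negP g) k)
    (trans (cong₂ _+_ fₖ≡gₖ (coeff-negP g k)) (+-inverseʳ (coeff g k)))

sumℚ : List ℚ → ℚ
sumℚ = foldr _+_ 0ℚ

e₂ : List ℚ → ℚ
e₂ []       = 0ℚ
e₂ (w ∷ ws) = w * sumℚ ws + e₂ ws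

-- The jet of ∏_{w ∈ ws} ((p - 1) + w p) / (p - 1) = ∏ (1 - w p - w p² - …).
ratioJet : List ℚ → Jet
ratioJet ws = ⟨ 1ℚ , - sumℚ ws , - sumℚ ws + e₂ ws ⟩

ratioJet-∷ : ∀ w ws → ratioJet (w ∷ ws) ≡ ⟨ 1ℚ , - w , - w ⟩ *ʲ ratioJet ws
ratioJet-∷ w ws = ⟨⟩-cong refl
  (solve 2 (λ w A → :- (w :+ A) := con 1ℚ :* (:- A) :+ (:- w) :* con 1ℚ) refl w (sumℚ ws))
  (solve 3 (λ w A B → :- (w :+ A) :+ (w :* A :+ B)
                   := con 1ℚ :* (:- A :+ B) :+ (:- w) :* (:- A) :+ (:- w) :* con 1ℚ)
         refl w (sumℚ ws) (e₂ ws))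

linear-factor-jet : ∀ w → ⟨ - 1ℚ , 1ℚ + w , 0ℚ ⟩ ≡ jet pm1 *ʲ ⟨ 1ℚ , - w , - w ⟩
linear-factor-jet w = ⟨⟩-cong refl
  (solve 1 (λ w → con 1ℚ :+ w := con (- 1ℚ) :* (:- w) :+ con 1ℚ :* con 1ℚ) refl w)
  (solve 1 (λ w → con 0ℚ := con (- 1ℚ) :* (:- w) :+ con 1ℚ :* (:- w) :+ con 0ℚ :* con 1ℚ)
         refl w)

jet-prodP : {A : Set} (F : A → Poly) (w : A → ℚ) →
            (∀ x → jet (F x) ≡ ⟨ - 1ℚ , 1ℚ + w x , 0ℚ ⟩) →
            ∀ xs → jet (prodP (map F xs)) ≡ jet (pm1 ^P length xs) *ʲ ratioJet (map w xs)
jet-prodP F w jet-F []       = refl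
jet-prodP F w jet-F (x ∷ xs) = begin
  jet (F x *P prodP (map F xs))
    ≡⟨ jet-*P (F x) _ ⟩
  jet (F x) *ʲ jet (prodP (map F xs))
    ≡⟨ cong₂ _*ʲ_ (trans (jet-F x) (linear-factor-jet (w x))) (jet-prodP F w jet-F xs) ⟩
  jet pm1 *ʲ ⟨ 1ℚ , - w x , - w x ⟩ *ʲ (jet (pm1 ^P length xs) *ʲ ratioJet (map w xs))
    ≡⟨ *ʲ-interchange (jet pm1) ⟨ 1ℚ , - w x , - w x ⟩ (jet (pm1 ^P length xs))
                      (ratioJet (map w xs)) ⟩
  jet pm1 *ʲ jet (pm1 ^P length xs) *ʲ (⟨ 1ℚ , - w x , - w x ⟩ *ʲ ratioJet (map w xs))
    ≡⟨ cong₂ _*ʲ_ (sym (jet-*P pm1 (pm1 ^P length xs))) (sym (ratioJet-∷ (w x) (map w xs))) ⟩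
  jet (pm1 ^P length (x ∷ xs)) *ʲ ratioJet (map w (x ∷ xs)) ∎

-- Averages over the assignments of vertices to halves

sumℚ-map-+ : {A : Set} (f g : A → ℚ) → ∀ xs →
             sumℚ (map (λ x → f x + g x) xs) ≡ sumℚ (map f xs) + sumℚ (map g xs)
sumℚ-map-+ f g []       = refl
sumℚ-map-+ f g (x ∷ xs) = trans (cong (f x + g x +_) (sumℚ-map-+ f g xs))
  (solve 4 (λ a b c d → a :+ b :+ (c :+ d) := a :+ c :+ (b :+ d))
         refl (f x) (g x) (sumℚ (map f xs)) (sumℚ (map g xs)))

sumℚ-map-*ˡ : {A : Set} (c : ℚ) (f : A → ℚ) → ∀ xs →
              sumℚ (map (λ x → c * f x) xs) ≡ c * sumℚ (map f xs)
sumℚ-map-*ˡ c f []       = sym (*-zeroʳ c)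
sumℚ-map-*ˡ c f (x ∷ xs) =
  trans (cong (c * f x +_) (sumℚ-map-*ˡ c f xs)) (sym (*-distribˡ-+ c (f x) (sumℚ (map f xs))))

sumℚ-map-neg : {A : Set} (f : A → ℚ) → ∀ xs → sumℚ (map (λ x → - f x) xs) ≡ - sumℚ (map f xs)
sumℚ-map-neg f []       = refl
sumℚ-map-neg f (x ∷ xs) = trans (cong (- f x +_) (sumℚ-map-neg f xs)) (sym (neg-distrib-+ (f x) _))

sumAssignments : (m : ℕ) → (Vec Bool m → ℚ) → ℚ
sumAssignments m g = sumℚ (map g (assignments m))

sumAssignments-cong : ∀ m {f g : Vec Bool m → ℚ} → (∀ σ → f σ ≡ g σ) →
                      sumAssignments m f ≡ sumAssignments m g
sumAssignments-cong m f≗g = cong sumℚ (map-cong f≗g (assignments m))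

sumAssignments-suc : ∀ m (g : Vec Bool (suc m) → ℚ) →
                     sumAssignments (suc m) g ≡ sumAssignments m (λ σ → g (false ∷ σ) + g (true ∷ σ))
sumAssignments-suc m g = go (assignments m)
  where
  go : ∀ σs → sumℚ (map g (concatMap (λ σ → (false ∷ σ) ∷ (true ∷ σ) ∷ []) σs))
            ≡ sumℚ (map (λ σ → g (false ∷ σ) + g (true ∷ σ)) σs)
  go []       = refl
  go (σ ∷ σs) = trans (cong (λ r → g (false ∷ σ) + (g (true ∷ σ) + r)) (go σs))
                      (sym (+-assoc (g (false ∷ σ)) (g (true ∷ σ)) _))

flipAt : ∀ {m} → Fin m → Vec Bool m → Vec Bool m
flipAt v σ = updateAt σ v not

sumAssignments-flipAt : ∀ m (v : Fin m) (g : Vec Bool m → ℚ) →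
                        sumAssignments m (g ∘ flipAt v) ≡ sumAssignments m g
sumAssignments-flipAt (suc m) fzero g = begin
  sumAssignments (suc m) (g ∘ flipAt fzero)              ≡⟨ sumAssignments-suc m _ ⟩
  sumAssignments m (λ σ → g (true ∷ σ) + g (false ∷ σ))  ≡⟨ sumAssignments-cong m (λ σ → +-comm (g (true ∷ σ)) _) ⟩
  sumAssignments m (λ σ → g (false ∷ σ) + g (true ∷ σ))  ≡⟨ sym (sumAssignments-suc m g) ⟩
  sumAssignments (suc m) g                               ∎
sumAssignments-flipAt (suc m) (fsuc v) g = begin
  sumAssignments (suc m) (g ∘ flipAt (fsuc v))           ≡⟨ sumAssignments-suc m _ ⟩
  sumAssignments m ((λ σ → g (false ∷ σ) + g (true ∷ σ)) ∘ flipAt v)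
    ≡⟨ sumAssignments-flipAt m v (λ σ → g (false ∷ σ) + g (true ∷ σ)) ⟩
  sumAssignments m (λ σ → g (false ∷ σ) + g (true ∷ σ))  ≡⟨ sym (sumAssignments-suc m g) ⟩
  sumAssignments (suc m) g                               ∎

mean : (m : ℕ) → (Vec Bool m → ℚ) → ℚ
mean m g = halfPow m * sumAssignments m g

mean-cong : ∀ m {f g : Vec Bool m → ℚ} → (∀ σ → f σ ≡ g σ) → mean m f ≡ mean m g
mean-cong m f≗g = cong (halfPow m *_) (sumAssignments-cong m f≗g)

mean-+ : ∀ m (f g : Vec Bool m → ℚ) → mean m (λ σ → f σ + g σ) ≡ mean m f + mean m g
mean-+ m f g = trans (cong (halfPow m *_) (sumℚ-map-+ f g (assignments m)))
  (solve 3 (λ h a b → h :* (a :+ b) := h :* a :+ h :* b) refl (halfPow m) _ _)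

mean-*ˡ : ∀ m c (g : Vec Bool m → ℚ) → mean m (λ σ → c * g σ) ≡ c * mean m g
mean-*ˡ m c g = trans (cong (halfPow m *_) (sumℚ-map-*ˡ c g (assignments m)))
  (solve 3 (λ h c s → h :* (c :* s) := c :* (h :* s)) refl (halfPow m) c _)

mean-one : ∀ m → mean m (λ _ → 1ℚ) ≡ 1ℚ
mean-one zero    = refl
mean-one (suc m) = begin
  ½ * halfPow m * sumAssignments (suc m) (λ _ → 1ℚ)
    ≡⟨ cong (½ * halfPow m *_)
            (trans (sumAssignments-suc m _) (sumℚ-map-*ˡ (1ℚ + 1ℚ) (λ _ → 1ℚ) (assignments m))) ⟩
  ½ * halfPow m * ((1ℚ + 1ℚ) * sumAssignments m (λ _ → 1ℚ))
    ≡⟨ solve 2 (λ h s → con ½ :* h :* ((con 1ℚ :+ con 1ℚ) :* s) := h :* s) refl (halfPow m) _ ⟩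
  mean m (λ _ → 1ℚ)
    ≡⟨ mean-one m ⟩
  1ℚ ∎

mean-const : ∀ m c → mean m (λ _ → c) ≡ c
mean-const m c = begin
  mean m (λ _ → c)          ≡⟨ mean-cong m (λ _ → sym (*-identityʳ c)) ⟩
  mean m (λ _ → c * 1ℚ)     ≡⟨ mean-*ˡ m c (λ _ → 1ℚ) ⟩
  c * mean m (λ _ → 1ℚ)     ≡⟨ cong (c *_) (mean-one m) ⟩
  c * 1ℚ                    ≡⟨ *-identityʳ c ⟩
  c                         ∎

x≡-x⇒x≡0 : ∀ x → x ≡ - x → x ≡ 0ℚ
x≡-x⇒x≡0 x x≡-x = begin
  x              ≡⟨ solve 1 (λ x → x := con ½ :* (x :+ x)) refl x ⟩
  ½ * (x + x)    ≡⟨ cong (λ y → ½ * (x + y)) x≡-x ⟩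
  ½ * (x + - x)  ≡⟨ cong (½ *_) (+-inverseʳ x) ⟩
  0ℚ             ∎

mean-odd : ∀ m (v : Fin m) (g : Vec Bool m → ℚ) → (∀ σ → g (flipAt v σ) ≡ - g σ) → mean m g ≡ 0ℚ
mean-odd m v g g-odd = trans (cong (halfPow m *_) (x≡-x⇒x≡0 _ sum≡-sum)) (*-zeroʳ (halfPow m))
  where
  sum≡-sum : sumAssignments m g ≡ - sumAssignments m g
  sum≡-sum = begin
    sumAssignments m g               ≡⟨ sym (sumAssignments-flipAt m v g) ⟩
    sumAssignments m (g ∘ flipAt v)  ≡⟨ sumAssignments-cong m g-odd ⟩
    sumAssignments m (λ σ → - g σ)   ≡⟨ sumℚ-map-neg g (assignments m) ⟩
    - sumAssignments m g             ∎

mean-affine : ∀ m {A B g : Vec Bool m → ℚ} {a b c} → mean m A ≡ 0ℚ → mean m B ≡ 0ℚ →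
              (∀ σ → g σ ≡ a + b * A σ + c * B σ) → mean m g ≡ a
mean-affine m {A} {B} {g} {a} {b} {c} A≡0 B≡0 g-affine = begin
  mean m g                                          ≡⟨ mean-cong m g-affine ⟩
  mean m (λ σ → a + b * A σ + c * B σ)              ≡⟨ mean-+ m _ _ ⟩
  mean m (λ σ → a + b * A σ) + mean m (λ σ → c * B σ)
    ≡⟨ cong₂ _+_ (mean-+ m _ _) (mean-*ˡ m c B) ⟩
  mean m (λ _ → a) + mean m (λ σ → b * A σ) + c * mean m B
    ≡⟨ cong₂ (λ x y → x + y + c * mean m B) (mean-const m a) (mean-*ˡ m b A) ⟩
  a + b * mean m A + c * mean m B                   ≡⟨ cong₂ (λ x y → a + b * x + c * y) A≡0 B≡0 ⟩
  a + b * 0ℚ + c * 0ℚ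
    ≡⟨ solve 3 (λ a b c → a :+ b :* con 0ℚ :+ c :* con 0ℚ := a) refl a b c ⟩
  a                                                 ∎

mean-sumℚ : ∀ m {A : Set} (f : Vec Bool m → A → ℚ) {xs} →
            All (λ x → mean m (λ σ → f σ x) ≡ 0ℚ) xs →
            mean m (λ σ → sumℚ (map (f σ) xs)) ≡ 0ℚ
mean-sumℚ m f []             = mean-const m 0ℚ
mean-sumℚ m f (x≡0 ∷ xs≡0) =
  trans (mean-+ m _ _) (trans (cong₂ _+_ x≡0 (mean-sumℚ m f xs≡0)) (+-identityʳ 0ℚ))

meanʲ : (m : ℕ) → (Vec Bool m → Jet) → Jet
meanʲ m v = ⟨ mean m (j₀ ∘ v) , mean m (j₁ ∘ v) , mean m (j₂ ∘ v) ⟩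

meanʲ-cong : ∀ m {u v : Vec Bool m → Jet} → (∀ σ → u σ ≡ v σ) → meanʲ m u ≡ meanʲ m v
meanʲ-cong m u≗v =
  ⟨⟩-cong (mean-cong m (cong j₀ ∘ u≗v)) (mean-cong m (cong j₁ ∘ u≗v)) (mean-cong m (cong j₂ ∘ u≗v))

coeff-sumP : {A : Set} (f : A → Poly) → ∀ xs k →
             coeff (sumP (map f xs)) k ≡ sumℚ (map (λ x → coeff (f x) k) xs)
coeff-sumP f []       k = refl
coeff-sumP f (x ∷ xs) k = trans (coeff-+P (f x) _ k) (cong (coeff (f x) k +_) (coeff-sumP f xs k))

jet-mean : ∀ m (f : Vec Bool m → Poly) →
           jet (halfPow m ·P sumP (map f (assignments m))) ≡ meanʲ m (jet ∘ f)
jet-mean m f = ⟨⟩-cong (coeff-mean 0) (coeff-mean 1) (coeff-mean 2)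
  where
  coeff-mean : ∀ k → coeff (halfPow m ·P sumP (map f (assignments m))) k ≡ mean m (λ σ → coeff (f σ) k)
  coeff-mean k = trans (coeff-·P (halfPow m) (sumP (map f (assignments m))) k)
                       (cong (halfPow m *_) (coeff-sumP f (assignments m) k))

meanʲ-*ʲ-ratioJet : ∀ m c (ws : Vec Bool m → List ℚ) →
                    mean m (sumℚ ∘ ws) ≡ 0ℚ → mean m (e₂ ∘ ws) ≡ 0ℚ →
                    meanʲ m (λ σ → c *ʲ ratioJet (ws σ)) ≡ c
meanʲ-*ʲ-ratioJet m ⟨ c₀ , c₁ , c₂ ⟩ ws e₁≡0 e₂≡0 = ⟨⟩-cong
  (affine c₀ 0ℚ 0ℚ λ σ →
     solve 3 (λ c₀ A B → c₀ :* con 1ℚ := c₀ :+ con 0ℚ :* A :+ con 0ℚ :* B) refl c₀ (A σ) (B σ))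
  (affine c₁ (- c₀) 0ℚ λ σ →
     solve 4 (λ c₀ c₁ A B → c₀ :* (:- A) :+ c₁ :* con 1ℚ := c₁ :+ (:- c₀) :* A :+ con 0ℚ :* B)
            refl c₀ c₁ (A σ) (B σ))
  (affine c₂ (- (c₀ + c₁)) c₀ λ σ →
     solve 5 (λ c₀ c₁ c₂ A B → c₀ :* (:- A :+ B) :+ c₁ :* (:- A) :+ c₂ :* con 1ℚ
                            := c₂ :+ (:- (c₀ :+ c₁)) :* A :+ c₀ :* B)
            refl c₀ c₁ c₂ (A σ) (B σ))
  where
  A B : Vec Bool m → ℚ
  A = sumℚ ∘ ws
  B = e₂ ∘ ws
  affine : ∀ {g : Vec Bool m → ℚ} a b c → (∀ σ → g σ ≡ a + b * A σ + c * B σ) → mean m g ≡ a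
  affine a b c = mean-affine m {b = b} {c} e₁≡0 e₂≡0

-- Edge signs

W : Bool → Bool → ℚ
W true  true  = 1ℚ
W false false = 1ℚ
W _     _     = - 1ℚ

jet-U : ∀ a b → jet (U a b) ≡ ⟨ - 1ℚ , 1ℚ + W a b , 0ℚ ⟩
jet-U true  true  = refl
jet-U true  false = refl
jet-U false true  = refl
jet-U false false = refl

W-notˡ : ∀ a b → W (not a) b ≡ - W a b
W-notˡ true  true  = refl
W-notˡ true  false = refl
W-notˡ false true  = refl
W-notˡ false false = refl

W-notʳ : ∀ a b → W a (not b) ≡ - W a b
W-notʳ true  true  = refl
W-notʳ true  false = refl
W-notʳ false true  = refl
W-notʳ false false = refl

edgeKernel : ∀ {m} → Vec Bool m → Fin m × Fin m → Poly
edgeKernel σ (i , j) = U (lookup σ i) (lookup σ j)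

edgeSign : ∀ {m} → Vec Bool m → Fin m × Fin m → ℚ
edgeSign σ (i , j) = W (lookup σ i) (lookup σ j)

edgeSign-flipAt-source : ∀ {m} {i j : Fin m} σ → i ≢ j →
                         edgeSign (flipAt i σ) (i , j) ≡ - edgeSign σ (i , j)
edgeSign-flipAt-source {i = i} {j} σ i≢j = begin
  W (lookup (flipAt i σ) i) (lookup (flipAt i σ) j)
    ≡⟨ cong₂ W (lookup∘updateAt i σ) (lookup∘updateAt′ j i (≢-sym i≢j) σ) ⟩
  W (not (lookup σ i)) (lookup σ j)                  ≡⟨ W-notˡ (lookup σ i) (lookup σ j) ⟩
  - W (lookup σ i) (lookup σ j)                      ∎

edgeSign-flipAt-target : ∀ {m} {i j : Fin m} σ → i ≢ j →
                         edgeSign (flipAt j σ) (i , j) ≡ - edgeSign σ (i , j)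
edgeSign-flipAt-target {i = i} {j} σ i≢j = begin
  W (lookup (flipAt j σ) i) (lookup (flipAt j σ) j)
    ≡⟨ cong₂ W (lookup∘updateAt′ i j i≢j σ) (lookup∘updateAt j σ) ⟩
  W (lookup σ i) (not (lookup σ j))                  ≡⟨ W-notʳ (lookup σ i) (lookup σ j) ⟩
  - W (lookup σ i) (lookup σ j)                      ∎

edgeSign-flipAt-outside : ∀ {m} {v i j : Fin m} σ → i ≢ v → j ≢ v →
                          edgeSign (flipAt v σ) (i , j) ≡ edgeSign σ (i , j)
edgeSign-flipAt-outside {v = v} {i} {j} σ i≢v j≢v =
  cong₂ W (lookup∘updateAt′ i v i≢v σ) (lookup∘updateAt′ j v j≢v σ)

mean-edgeSign : ∀ m (i j : Fin m) → i ≢ j → mean m (λ σ → edgeSign σ (i , j)) ≡ 0ℚ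
mean-edgeSign m i j i≢j = mean-odd m i _ (λ σ → edgeSign-flipAt-source σ i≢j)

mean-odd-* : ∀ m (v : Fin m) (g h : Vec Bool m → ℚ) →
             (∀ σ → g (flipAt v σ) ≡ - g σ) → (∀ σ → h (flipAt v σ) ≡ h σ) →
             mean m (λ σ → g σ * h σ) ≡ 0ℚ
mean-odd-* m v g h g-odd h-even = mean-odd m v _ λ σ →
  trans (cong₂ _*_ (g-odd σ) (h-even σ)) (sym (neg-distribˡ-* (g σ) (h σ)))

-- Flip a vertex on exactly one of the two edges: j if i is shared, i otherwise.
mean-edgeSign-* : ∀ m (e e′ : Fin m × Fin m) → uncurry _<_ e → uncurry _<_ e′ → e ≢ e′ →
                  mean m (λ σ → edgeSign σ e * edgeSign σ e′) ≡ 0ℚ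
mean-edgeSign-* m (i , j) (k , l) i<j k<l e≢e′ with i ≟ k | i ≟ l
... | yes refl | _        = mean-odd-* m j _ _ (λ σ → edgeSign-flipAt-target σ (<⇒≢ i<j))
  (λ σ → edgeSign-flipAt-outside σ (<⇒≢ i<j) (λ l≡j → e≢e′ (cong (i ,_) (sym l≡j))))
... | no _     | yes refl = mean-odd-* m j _ _ (λ σ → edgeSign-flipAt-target σ (<⇒≢ i<j))
  (λ σ → edgeSign-flipAt-outside σ (<⇒≢ (<-trans k<l i<j)) (<⇒≢ i<j))
... | no i≢k   | no i≢l   = mean-odd-* m i _ _ (λ σ → edgeSign-flipAt-source σ (<⇒≢ i<j))
  (λ σ → edgeSign-flipAt-outside σ (≢-sym i≢k) (≢-sym i≢l))

mean-sum-edgeSign : ∀ m {L : List (Fin m × Fin m)} → All (uncurry _<_) L →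
                    mean m (λ σ → sumℚ (map (edgeSign σ) L)) ≡ 0ℚ
mean-sum-edgeSign m increasing =
  mean-sumℚ m edgeSign
    (All.map (λ {e} e< → mean-edgeSign m (proj₁ e) (proj₂ e) (<⇒≢ e<)) increasing)

mean-e₂-edgeSign : ∀ m {L : List (Fin m × Fin m)} → Unique L → All (uncurry _<_) L →
                   mean m (λ σ → e₂ (map (edgeSign σ) L)) ≡ 0ℚ
mean-e₂-edgeSign m {[]}    []               []                 = mean-const m 0ℚ
mean-e₂-edgeSign m {e ∷ L} (e∉L ∷ unique) (e< ∷ increasing) =
  trans (mean-+ m _ _)
        (trans (cong₂ _+_ cross (mean-e₂-edgeSign m unique increasing)) (+-identityʳ 0ℚ))
  where
  cross : mean m (λ σ → edgeSign σ e * sumℚ (map (edgeSign σ) L)) ≡ 0ℚ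
  cross = trans (mean-cong m (λ σ → sym (sumℚ-map-*ˡ (edgeSign σ e) (edgeSign σ) L)))
    (mean-sumℚ m (λ σ e′ → edgeSign σ e * edgeSign σ e′)
      (All.zipWith (λ {e′} (e′< , e≢e′) → mean-edgeSign-* m e e′ e< e′< e≢e′) (increasing , e∉L)))

concatMap-pairs≡cartesianProduct : {A B : Set} (xs : List A) (ys : List B) →
                                   concatMap (λ x → map (x ,_) ys) xs ≡ cartesianProduct xs ys
concatMap-pairs≡cartesianProduct []       ys = refl
concatMap-pairs≡cartesianProduct (x ∷ xs) ys =
  cong (map (x ,_) ys ++_) (concatMap-pairs≡cartesianProduct xs ys)

module _ (H : Graph) where
  private
    vertexPairs : List (Fin (n H) × Fin (n H))
    vertexPairs = concatMap (λ i → map (i ,_) (allFin (n H))) (allFin (n H))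

    isEdge : Fin (n H) × Fin (n H) → Bool
    isEdge (i , j) = (toℕ i ℕ.<ᵇ toℕ j) ∧ adj H i j

  edges-increasing : All (uncurry _<_) (edges H)
  edges-increasing =
    All.map (λ {(i , j)} selected → <ᵇ⇒< (toℕ i) (toℕ j) (proj₁ (Equivalence.to T-∧ selected)))
            (all-filter (T? ∘ isEdge) vertexPairs)

  edges-unique : Unique (edges H)
  edges-unique =
    filter⁺ (T? ∘ isEdge) (subst Unique (sym (concatMap-pairs≡cartesianProduct (allFin (n H)) (allFin (n H))))
                                 (cartesianProduct⁺ (allFin⁺ (n H)) (allFin⁺ (n H))))

jet-tU : (H : Graph) → jet (tU H) ≡ jet (pm1 ^P e H)
jet-tU H = begin
  jet (tU H)
    ≡⟨ jet-mean (n H) _ ⟩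
  meanʲ (n H) (λ σ → jet (prodP (map (edgeKernel σ) (edges H))))
    ≡⟨ meanʲ-cong (n H) (λ σ → jet-prodP (edgeKernel σ) (edgeSign σ)
                                           (λ (i , j) → jet-U (lookup σ i) (lookup σ j)) (edges H)) ⟩
  meanʲ (n H) (λ σ → jet (pm1 ^P e H) *ʲ ratioJet (map (edgeSign σ) (edges H)))
    ≡⟨ meanʲ-*ʲ-ratioJet (n H) (jet (pm1 ^P e H)) (λ σ → map (edgeSign σ) (edges H))
         (mean-sum-edgeSign (n H) (edges-increasing H))
         (mean-e₂-edgeSign (n H) (edges-unique H) (edges-increasing H)) ⟩
  jet (pm1 ^P e H) ∎

lemma3p5 : (H : Graph) → (X ^P 3) ∣P Δ H
lemma3p5 H = X³∣P-difference (tU H) (pm1 ^P e H) (jet-tU H)
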